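{- Let $V_1,V_2$ be disjoint finite sets and $\mathcal{H}^1\subseteq 2^{V_1}$, $\mathcal{H}^2\subseteq 2^{V_2}$ hypergraphs satisfying property (B). Then $\mathcal{H}=\mathcal{H}^1\otimes\mathcal{H}^2$ also satisfies property (B).
   Context: A hypergraph on a finite set $V$ is a family $\mathcal{H}\subseteq 2^V$ of nonempty edges covering $V$. In Nim$_\mathcal{H}$ a move $\mathbf{x}\to\mathbf{x}'$ on $\mathbb{Z}_+^V$ chooses $H\in\mathcal{H}$ and has $x'_i<x_i$ for $i\in H$, $x'_i=x_i$ otherwise. Height $h_\mathcal{H}(\mathbf{x})$: maximum number of consecutive moves from $\mathbf{x}$; $m(\mathbf{x})=\min_ix_i$. Property (B): for every position $\mathbf{x}$ with $m(\mathbf{x})>0$ there is a move $\mathbf{x}\to\mathbf{x}'$ with $m(\mathbf{x}')<m(\mathbf{x})$, $h_\mathcal{H}(\mathbf{x}')=h_\mathcal{H}(\mathbf{x})-1$, and $x_i-x'_i\leq1$ for all $i$. Conjunctive compound: $\mathcal{H}^1\otimes\mathcal{H}^2=\{H^1\cup H^2\mid H^1\in\mathcal{H}^1,H^2\in\mathcal{H}^2\}$ on $V_1\cup V_2$. -}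

module Defs where

open import Data.Nat using (ℕ; zero; suc; _+_; _∸_; _≤_; _<_; _⊓_)
open import Data.Fin using (Fin)
import Data.Fin as F
open import Data.Fin.Subset using (Subset; _∈_; _∉_; Nonempty)
open import Data.Vec using (_++_)
open import Data.Product using (Σ; ∃; ∃-syntax; _×_; _,_)
open import Relation.Binary.PropositionalEquality using (_≡_)
open import Relation.Nullary using (¬_)

-- A family of subsets of the vertex set V = Fin n (given as a predicate
-- on subsets; automatically finite since Subset n is finite).
Family : ℕ → Set₁
Family n = Subset n → Set

record IsHypergraph {n : ℕ} (𝓗 : Family n) : Set where
  field
    nonempty : ∀ E → 𝓗 E → Nonempty E
    covers   : ∀ (i : Fin n) → ∃[ E ] (𝓗 E × i ∈ E)

Position : ℕ → Set
Position n = Fin n → ℕ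

Move : ∀ {n} → Family n → Position n → Position n → Set
Move 𝓗 x x' = ∃[ E ] (𝓗 E × (∀ i → i ∈ E → x' i < x i) × (∀ i → i ∉ E → x' i ≡ x i))

data Chain {n : ℕ} (𝓗 : Family n) : Position n → ℕ → Set where
  done : ∀ {x} → Chain 𝓗 x 0
  step : ∀ {x x' k} → Move 𝓗 x x' → Chain 𝓗 x' k → Chain 𝓗 x (suc k)

IsHeight : ∀ {n} → Family n → Position n → ℕ → Set
IsHeight 𝓗 x k = Chain 𝓗 x k × ¬ Chain 𝓗 x (suc k)

-- m(x) = min_i x_i  (vertex set nonempty: Fin (suc n))
m : ∀ {n} → Position (suc n) → ℕ
m {zero}  x = x F.zero
m {suc n} x = x F.zero ⊓ m (λ i → x (F.suc i))

PropertyB : ∀ {n} → Family (suc n) → Set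
PropertyB {n} 𝓗 = ∀ (x : Position (suc n)) → 0 < m x →
  ∃[ x' ] (Move 𝓗 x x' × m x' < m x
           × (∃[ k ] (IsHeight 𝓗 x k × IsHeight 𝓗 x' (k ∸ 1)))
           × (∀ i → x i ∸ x' i ≤ 1))

-- Conjunctive compound on the disjoint union V1 ⊔ V2 = Fin (n1 + n2)
-- (first n1 coordinates = V1, last n2 = V2); H1 ∪ H2 is H1 ++ H2.
_⊗_ : ∀ {n₁ n₂} → Family n₁ → Family n₂ → Family (n₁ + n₂)
(𝓗₁ ⊗ 𝓗₂) E = ∃[ E₁ ] ∃[ E₂ ] (𝓗₁ E₁ × 𝓗₂ E₂ × E ≡ E₁ ++ E₂)

-- Write x¹, x² for the restrictions of a position x to V₁ and V₂. A move of H¹ ⊗ H²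
-- is exactly a simultaneous move on both parts, so h(x) = min (h¹ x¹) (h² x²), and
-- m x = min (m x¹) (m x²). Applying (B) to both parts at once therefore lowers both
-- minima and both heights by one, and no coordinate by more than one.
module Submission where

open import Defs
open import Data.Nat using (ℕ; zero; suc; _+_; _≤_; _<_; _⊓_; _∸_; z≤n; s≤s; _≤?_)
open import Data.Nat.Properties
  using (⊓-assoc; m⊓n≤m; m⊓n≤n; ⊓-glb; ⊓-mono-<; m<n⊓o⇒m<n; m<n⊓o⇒m<o;
         ∸-distribʳ-⊓; ≰⇒>; n≮n; module ≤-Reasoning)
open import Data.Fin using (Fin; _↑ˡ_; _↑ʳ_; splitAt; join)
import Data.Fin as Fin
open import Data.Fin.Properties using (join-splitAt)
open import Data.Fin.Subset using (Subset; _∈_; _∉_)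
open import Data.Vec using (_++_; lookup)
import Data.Vec.Properties as Vec
open import Data.Vec.Functional using (take; drop) renaming (_++_ to _++ᶠ_)
import Data.Vec.Functional.Properties as Vecᶠ
open import Data.Sum using ([_,_])
open import Data.Product using (_,_)
open import Data.Empty using (⊥-elim)
open import Function using (_∘_)
open import Relation.Binary.PropositionalEquality
  using (_≡_; _≗_; refl; sym; trans; cong; cong₂; subst; subst₂)
open import Relation.Nullary using (yes; no)

private
  variable
    a b n : ℕ

↑-elim : ∀ {ℓ} (P : Fin (a + b) → Set ℓ) →
         (∀ j → P (j ↑ˡ b)) → (∀ j → P (a ↑ʳ j)) → ∀ i → P i
↑-elim {a} {b} P pˡ pʳ i =
  subst P (join-splitAt a b i) ([_,_] {C = P ∘ join a b} pˡ pʳ (splitAt a i))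

∈-resp-lookup : ∀ {p : Subset a} {q : Subset b} {i j} →
                lookup p i ≡ lookup q j → i ∈ p → j ∈ q
∈-resp-lookup p[i]≡q[j] i∈p =
  Vec.lookup⇒[]= _ _ (trans (sym p[i]≡q[j]) (Vec.[]=⇒lookup i∈p))

module _ (E₁ : Subset a) (E₂ : Subset b) where

  ∈-++⁺ˡ : ∀ {j} → j ∈ E₁ → j ↑ˡ b ∈ E₁ ++ E₂
  ∈-++⁺ˡ = ∈-resp-lookup (sym (Vec.lookup-++ˡ E₁ E₂ _))

  ∈-++⁻ˡ : ∀ {j} → j ↑ˡ b ∈ E₁ ++ E₂ → j ∈ E₁
  ∈-++⁻ˡ = ∈-resp-lookup (Vec.lookup-++ˡ E₁ E₂ _)

  ∈-++⁺ʳ : ∀ {j} → j ∈ E₂ → a ↑ʳ j ∈ E₁ ++ E₂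
  ∈-++⁺ʳ = ∈-resp-lookup (sym (Vec.lookup-++ʳ E₁ E₂ _))

  ∈-++⁻ʳ : ∀ {j} → a ↑ʳ j ∈ E₁ ++ E₂ → j ∈ E₂
  ∈-++⁻ʳ = ∈-resp-lookup (Vec.lookup-++ʳ E₁ E₂ _)

take-++-drop : ∀ a {b} (x : Position (a + b)) → take a x ++ᶠ drop a x ≗ x
take-++-drop a x = ↑-elim _ (Vecᶠ.lookup-++ˡ (take a x) (drop a x))
                            (Vecᶠ.lookup-++ʳ (take a x) (drop a x))

++ᶠ-pointwise : ∀ (R : Fin (a + b) → ℕ → ℕ → Set) {x₁ y₁ : Position a} {x₂ y₂ : Position b} →
                (∀ j → R (j ↑ˡ b) (x₁ j) (y₁ j)) → (∀ j → R (a ↑ʳ j) (x₂ j) (y₂ j)) →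
                ∀ i → R i ((x₁ ++ᶠ x₂) i) ((y₁ ++ᶠ y₂) i)
++ᶠ-pointwise R {x₁} {y₁} {x₂} {y₂} r₁ r₂ = ↑-elim _
  (λ j → subst₂ (R _) (sym (Vecᶠ.lookup-++ˡ x₁ x₂ j)) (sym (Vecᶠ.lookup-++ˡ y₁ y₂ j)) (r₁ j))
  (λ j → subst₂ (R _) (sym (Vecᶠ.lookup-++ʳ x₁ x₂ j)) (sym (Vecᶠ.lookup-++ʳ y₁ y₂ j)) (r₂ j))

module _ {𝓗 : Family n} where

  Move-resp-≗ : ∀ {x x′ y} → x ≗ x′ → Move 𝓗 x y → Move 𝓗 x′ y
  Move-resp-≗ x≗x′ (E , E∈𝓗 , lower , keep) =
    E , E∈𝓗 , (λ i i∈E → subst (_ <_) (x≗x′ i) (lower i i∈E))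
            , (λ i i∉E → trans (keep i i∉E) (x≗x′ i))

  Chain-resp-≗ : ∀ {x x′ k} → x ≗ x′ → Chain 𝓗 x k → Chain 𝓗 x′ k
  Chain-resp-≗ x≗x′ done        = done
  Chain-resp-≗ x≗x′ (step mv c) = step (Move-resp-≗ x≗x′ mv) c

  IsHeight-resp-≗ : ∀ {x x′ k} → x ≗ x′ → IsHeight 𝓗 x k → IsHeight 𝓗 x′ k
  IsHeight-resp-≗ x≗x′ (c , ¬c) = Chain-resp-≗ x≗x′ c , ¬c ∘ Chain-resp-≗ (sym ∘ x≗x′)

  Chain-prefix : ∀ {x j k} → j ≤ k → Chain 𝓗 x k → Chain 𝓗 x j
  Chain-prefix z≤n       c           = done
  Chain-prefix (s≤s j≤k) (step mv c) = step mv (Chain-prefix j≤k c)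

  Chain⇒≤height : ∀ {x h k} → IsHeight 𝓗 x h → Chain 𝓗 x k → k ≤ h
  Chain⇒≤height {h = h} {k} (_ , ¬c) c with k ≤? h
  ... | yes k≤h = k≤h
  ... | no  k≰h = ⊥-elim (¬c (Chain-prefix (≰⇒> k≰h) c))

module _ {𝓗₁ : Family a} {𝓗₂ : Family b} where

  ⊗-move⁻ˡ : ∀ {x y} → Move (𝓗₁ ⊗ 𝓗₂) x y → Move 𝓗₁ (take a x) (take a y)
  ⊗-move⁻ˡ (_ , (E₁ , E₂ , E₁∈𝓗₁ , _ , refl) , lower , keep) =
    E₁ , E₁∈𝓗₁ , (λ j → lower _ ∘ ∈-++⁺ˡ E₁ E₂)
               , (λ j j∉E₁ → keep _ (j∉E₁ ∘ ∈-++⁻ˡ E₁ E₂))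

  ⊗-move⁻ʳ : ∀ {x y} → Move (𝓗₁ ⊗ 𝓗₂) x y → Move 𝓗₂ (drop a x) (drop a y)
  ⊗-move⁻ʳ (_ , (E₁ , E₂ , _ , E₂∈𝓗₂ , refl) , lower , keep) =
    E₂ , E₂∈𝓗₂ , (λ j → lower _ ∘ ∈-++⁺ʳ E₁ E₂)
               , (λ j j∉E₂ → keep _ (j∉E₂ ∘ ∈-++⁻ʳ E₁ E₂))

  ⊗-move⁺ : ∀ {x₁ y₁ x₂ y₂} → Move 𝓗₁ x₁ y₁ → Move 𝓗₂ x₂ y₂ →
            Move (𝓗₁ ⊗ 𝓗₂) (x₁ ++ᶠ x₂) (y₁ ++ᶠ y₂)
  ⊗-move⁺ (E₁ , E₁∈𝓗₁ , lower₁ , keep₁) (E₂ , E₂∈𝓗₂ , lower₂ , keep₂) =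
    E₁ ++ E₂ , (E₁ , E₂ , E₁∈𝓗₁ , E₂∈𝓗₂ , refl)
    , ++ᶠ-pointwise (λ i u v → i ∈ E₁ ++ E₂ → v < u)
        (λ j → lower₁ j ∘ ∈-++⁻ˡ E₁ E₂) (λ j → lower₂ j ∘ ∈-++⁻ʳ E₁ E₂)
    , ++ᶠ-pointwise (λ i u v → i ∉ E₁ ++ E₂ → v ≡ u)
        (λ j j∉E → keep₁ j (j∉E ∘ ∈-++⁺ˡ E₁ E₂)) (λ j j∉E → keep₂ j (j∉E ∘ ∈-++⁺ʳ E₁ E₂))

  ⊗-chain⁻ˡ : ∀ {x k} → Chain (𝓗₁ ⊗ 𝓗₂) x k → Chain 𝓗₁ (take a x) k
  ⊗-chain⁻ˡ done        = done
  ⊗-chain⁻ˡ (step mv c) = step (⊗-move⁻ˡ mv) (⊗-chain⁻ˡ c)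

  ⊗-chain⁻ʳ : ∀ {x k} → Chain (𝓗₁ ⊗ 𝓗₂) x k → Chain 𝓗₂ (drop a x) k
  ⊗-chain⁻ʳ done        = done
  ⊗-chain⁻ʳ (step mv c) = step (⊗-move⁻ʳ mv) (⊗-chain⁻ʳ c)

  ⊗-chain⁺ : ∀ {x₁ x₂ k} → Chain 𝓗₁ x₁ k → Chain 𝓗₂ x₂ k → Chain (𝓗₁ ⊗ 𝓗₂) (x₁ ++ᶠ x₂) k
  ⊗-chain⁺ done          done          = done
  ⊗-chain⁺ (step mv₁ c₁) (step mv₂ c₂) = step (⊗-move⁺ mv₁ mv₂) (⊗-chain⁺ c₁ c₂)

  ⊗-height : ∀ {x k₁ k₂} → IsHeight 𝓗₁ (take a x) k₁ → IsHeight 𝓗₂ (drop a x) k₂ →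
             IsHeight (𝓗₁ ⊗ 𝓗₂) x (k₁ ⊓ k₂)
  ⊗-height {x} {k₁} {k₂} h₁@(c₁ , _) h₂@(c₂ , _) =
    Chain-resp-≗ (take-++-drop a x)
      (⊗-chain⁺ (Chain-prefix (m⊓n≤m k₁ k₂) c₁) (Chain-prefix (m⊓n≤n k₁ k₂) c₂)) ,
    λ c → n≮n _ (⊓-glb (Chain⇒≤height h₁ (⊗-chain⁻ˡ c)) (Chain⇒≤height h₂ (⊗-chain⁻ʳ c)))

m-resp-≗ : ∀ {x y : Position (suc n)} → x ≗ y → m x ≡ m y
m-resp-≗ {zero}  x≗y = x≗y Fin.zero
m-resp-≗ {suc n} x≗y = cong₂ _⊓_ (x≗y Fin.zero) (m-resp-≗ (x≗y ∘ Fin.suc))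

m-split : ∀ n₁ {n₂} (x : Position (suc n₁ + suc n₂)) →
          m x ≡ m (take (suc n₁) x) ⊓ m (drop (suc n₁) x)
m-split zero     x = refl
m-split (suc n₁) x =
  trans (cong (x Fin.zero ⊓_) (m-split n₁ (x ∘ Fin.suc))) (sym (⊓-assoc (x Fin.zero) _ _))

m-++ : ∀ {n₁ n₂} (x₁ : Position (suc n₁)) (x₂ : Position (suc n₂)) →
       m (x₁ ++ᶠ x₂) ≡ m x₁ ⊓ m x₂
m-++ {n₁} x₁ x₂ = trans (m-split n₁ (x₁ ++ᶠ x₂))
  (cong₂ _⊓_ (m-resp-≗ (Vecᶠ.lookup-++ˡ x₁ x₂)) (m-resp-≗ (Vecᶠ.lookup-++ʳ x₁ x₂)))

lemma8 : ∀ {n₁ n₂ : ℕ} (𝓗₁ : Family (suc n₁)) (𝓗₂ : Family (suc n₂)) →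
    IsHypergraph 𝓗₁ → IsHypergraph 𝓗₂ →
    PropertyB 𝓗₁ → PropertyB 𝓗₂ → PropertyB (𝓗₁ ⊗ 𝓗₂)
lemma8 {n₁} 𝓗₁ 𝓗₂ _ _ B₁ B₂ x 0<mx
  with B₁ (take (suc n₁) x) (m<n⊓o⇒m<n _ _ 0<mx₁⊓mx₂)
     | B₂ (drop (suc n₁) x) (m<n⊓o⇒m<o _ _ 0<mx₁⊓mx₂)
  where 0<mx₁⊓mx₂ = subst (0 <_) (m-split n₁ x) 0<mx
... | y₁ , mv₁ , my₁<mx₁ , (k₁ , hx₁ , hy₁) , δ₁ | y₂ , mv₂ , my₂<mx₂ , (k₂ , hx₂ , hy₂) , δ₂ =
  y₁ ++ᶠ y₂ ,
  Move-resp-≗ (take-++-drop (suc n₁) x) (⊗-move⁺ mv₁ mv₂) ,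
  m-decreases ,
  (k₁ ⊓ k₂ , ⊗-height hx₁ hx₂ , subst (IsHeight _ _) (sym (∸-distribʳ-⊓ 1 k₁ k₂)) height-y) ,
  steps-≤1
  where
  open ≤-Reasoning
  m-decreases : m (y₁ ++ᶠ y₂) < m x
  m-decreases = begin-strict
    m (y₁ ++ᶠ y₂)                                  ≡⟨ m-++ y₁ y₂ ⟩
    m y₁ ⊓ m y₂                                    <⟨ ⊓-mono-< my₁<mx₁ my₂<mx₂ ⟩
    m (take (suc n₁) x) ⊓ m (drop (suc n₁) x)      ≡⟨ m-split n₁ x ⟨
    m x                                            ∎
  steps-≤1 : ∀ i → x i ∸ (y₁ ++ᶠ y₂) i ≤ 1
  steps-≤1 i = subst (λ u → u ∸ (y₁ ++ᶠ y₂) i ≤ 1) (take-++-drop (suc n₁) x i)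
                     (++ᶠ-pointwise (λ _ u v → u ∸ v ≤ 1) δ₁ δ₂ i)
  height-y : IsHeight (𝓗₁ ⊗ 𝓗₂) (y₁ ++ᶠ y₂) ((k₁ ∸ 1) ⊓ (k₂ ∸ 1))
  height-y = ⊗-height (IsHeight-resp-≗ (sym ∘ Vecᶠ.lookup-++ˡ y₁ y₂) hy₁)
                       (IsHeight-resp-≗ (sym ∘ Vecᶠ.lookup-++ʳ y₁ y₂) hy₂)
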